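{- Let $\pi_1,\dots,\pi_5$ be permutations of $Q_5$. The layer-latin cube of order $5$ whose $i$-th layer is the latin square $L[\pi_i,2]$, $(x_1,x_2)\mapsto\pi_i(x_1)+x_2 \pmod 5$, $i=1,\dots,5$, has no transversal if the row-latin square whose $i$-th row is $(\pi_i(0),\dots,\pi_i(4))$ has no diagonal with sum $0$ modulo $5$.
   Context: $Q_5=\{0,\dots,4\}$. A layer-latin cube of order $5$ is an array $C:Q_5^3\to Q_5$ such that each layer $(x_1,x_2)\mapsto C(i,x_1,x_2)$ is a latin square of order $5$. A hyperplane of $C$ is the set of cells obtained by fixing any one of its three coordinates; a transversal of $C$ is a set of $5$ cells with at most one cell in each hyperplane and pairwise distinct symbols. A row-latin square is a $5\times5$ array over $Q_5$ each of whose rows contains all symbols; a diagonal of it is a set of $5$ cells with pairwise distinct rows and pairwise distinct columns, and its sum is the sum of its entries modulo $5$. -}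

module Defs where

open import Data.Nat using (ℕ; _+_; _%_)
open import Data.Fin using (Fin; toℕ; fromℕ<)
open import Data.Fin.Permutation using (Permutation′; _⟨$⟩ʳ_)
open import Data.Nat.DivMod using (m%n<n)
open import Data.Product using (_×_; _,_; proj₁; proj₂; ∃-syntax; Σ-syntax)
open import Data.Vec using (foldr; tabulate)
open import Function.Definitions using (Injective)
open import Relation.Binary.PropositionalEquality using (_≡_)

Q5 : Set
Q5 = Fin 5

_⊕_ : Q5 → Q5 → Q5
a ⊕ b = fromℕ< (m%n<n (toℕ a + toℕ b) 5)

Cell : Set
Cell = Q5 × Q5 × Q5

Square : Set
Square = Q5 → Q5 → Q5

Cube : Set
Cube = Q5 → Q5 → Q5 → Q5

IsLatinSquare : Square → Set
IsLatinSquare L = (∀ r → Injective _≡_ _≡_ (L r)) × (∀ c → Injective _≡_ _≡_ (λ r → L r c))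

IsLayerLatin : Cube → Set
IsLayerLatin C = ∀ i → IsLatinSquare (C i)

c₀ c₁ c₂ : Cell → Q5
c₀ (a , _ , _) = a
c₁ (_ , b , _) = b
c₂ (_ , _ , c) = c

symbol : Cube → Cell → Q5
symbol C (a , b , c) = C a b c

-- A transversal is a set of 5 cells, here enumerated as T : Fin 5 → Cell,
-- with at most one cell in each hyperplane (each coordinate injective,
-- which also makes the 5 cells distinct) and pairwise distinct symbols.
IsTransversal : Cube → (Fin 5 → Cell) → Set
IsTransversal C T =
  Injective _≡_ _≡_ (λ k → c₀ (T k)) ×
  Injective _≡_ _≡_ (λ k → c₁ (T k)) ×
  Injective _≡_ _≡_ (λ k → c₂ (T k)) ×
  Injective _≡_ _≡_ (λ k → symbol C (T k))

HasTransversal : Cube → Set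
HasTransversal C = ∃[ T ] IsTransversal C T

L[_,2] : Permutation′ 5 → Square
L[ π ,2] x₁ x₂ = (π ⟨$⟩ʳ x₁) ⊕ x₂

cubeOf : (Q5 → Permutation′ 5) → Cube
cubeOf π i = L[ π i ,2]

IsRowLatin : Square → Set
IsRowLatin R = ∀ r → Injective _≡_ _≡_ (R r)

rowSquareOf : (Q5 → Permutation′ 5) → Square
rowSquareOf π i x = π i ⟨$⟩ʳ x

-- a diagonal: row r ↦ cell (r , σ r) with σ injective (distinct columns);
-- its sum is Σ_r R(r, σ r) mod 5
diagSum : Square → (Q5 → Q5) → Q5
diagSum R σ = foldr _ _⊕_ Data.Fin.zero (tabulate (λ r → R r (σ r)))

IsDiagonal : (Q5 → Q5) → Set
IsDiagonal σ = Injective _≡_ _≡_ σ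

HasZeroSumDiagonal : Square → Set
HasZeroSumDiagonal R = ∃[ σ ] (IsDiagonal σ × diagSum R σ ≡ Data.Fin.zero)

-- A transversal T picks cells (aₖ, bₖ, cₖ) with a, b, c bijections of Q₅, and its
-- symbols sₖ = π_{aₖ}(bₖ) + cₖ form another bijection of Q₅. Summing in ℤ₅, both Σ sₖ
-- and Σ cₖ equal 0 + 1 + 2 + 3 + 4 = 0, so Σ π_{aₖ}(bₖ) = 0. Reindexing by r = aₖ,
-- this is the sum of the diagonal r ↦ (r, b(a⁻¹ r)) of the row-latin square.
module Submission where

open import Defs
open import Algebra.Bundles using (CommutativeMonoid)
open import Algebra.Structures using (IsCommutativeMonoid)
import Algebra.Properties.CommutativeMonoid.Sum as CommutativeMonoidSum
open import Data.Empty using (⊥-elim)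
open import Data.Fin using (Fin; toℕ; punchOut; _≟_)
open import Data.Fin.Permutation
  using (Permutation′; _⟨$⟩ʳ_; _⟨$⟩ˡ_; permutation; inverseˡ; flip; _∘ₚ_)
open import Data.Fin.Properties
  using (toℕ-fromℕ<; toℕ-injective; toℕ<n; punchOut-injective; pigeonhole; <⇒≢; any?)
open import Data.Fin.Patterns using (0F)
open import Data.Nat using (ℕ; suc; _+_; _%_; NonZero)
open import Data.Nat.DivMod using (%-distribˡ-+; m%n%n≡m%n; m%n<n; m<n⇒m%n≡m)
open import Data.Nat.Properties using (+-assoc; +-comm; n<1+n)
open import Data.Product using (_,_; proj₁; proj₂; ∃-syntax)
open import Function using (_∘_)
open import Level using (0ℓ)
open import Function.Bundles using (Injection)
open import Function.Definitions using (Injective)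
open import Function.Properties.Inverse using (↔⇒↣)
open import Relation.Binary.PropositionalEquality
open import Relation.Nullary using (¬_; yes; no)

private
  variable
    n : ℕ

-- Punching the missed value y out of f gives a map Fin (suc n) → Fin n, which must collide.
missing-value⇒¬injective : {f : Fin (suc n) → Fin (suc n)} (y : Fin (suc n)) →
                           (∀ x → y ≢ f x) → ¬ Injective _≡_ _≡_ f
missing-value⇒¬injective {n} y y≢f f-inj
  with i , j , i<j , same ← pigeonhole (n<1+n n) (λ x → punchOut (y≢f x))
  = <⇒≢ i<j (f-inj (punchOut-injective (y≢f i) (y≢f j) same))

injective⇒surjective : {f : Fin n → Fin n} → Injective _≡_ _≡_ f → ∀ y → ∃[ x ] f x ≡ y
injective⇒surjective {suc n} {f} f-inj y with any? (λ x → f x ≟ y)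
... | yes hit = hit
... | no miss = ⊥-elim (missing-value⇒¬injective y (λ x y≡fx → miss (x , sym y≡fx)) f-inj)

injective⇒permutation : (f : Fin n → Fin n) → Injective _≡_ _≡_ f → Permutation′ n
injective⇒permutation {n} f f-inj = permutation f f⁻¹ f∘f⁻¹ (λ x → f-inj (f∘f⁻¹ (f x)))
  where
  f⁻¹ : Fin n → Fin n
  f⁻¹ y = proj₁ (injective⇒surjective f-inj y)
  f∘f⁻¹ : ∀ y → f (f⁻¹ y) ≡ y
  f∘f⁻¹ y = proj₂ (injective⇒surjective f-inj y)

⟨$⟩ʳ-injective : (P : Permutation′ n) → Injective _≡_ _≡_ (P ⟨$⟩ʳ_)
⟨$⟩ʳ-injective P = Injection.injective (↔⇒↣ P)

[m%d+n]%d≡[m+n]%d : ∀ m n d .{{_ : NonZero d}} → (m % d + n) % d ≡ (m + n) % d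
[m%d+n]%d≡[m+n]%d m n d = begin
  (m % d + n) % d         ≡⟨ %-distribˡ-+ (m % d) n d ⟩
  (m % d % d + n % d) % d ≡⟨ cong (λ x → (x + n % d) % d) (m%n%n≡m%n m d) ⟩
  (m % d + n % d) % d     ≡⟨ %-distribˡ-+ m n d ⟨
  (m + n) % d             ∎
  where open ≡-Reasoning

[m+n%d]%d≡[m+n]%d : ∀ m n d .{{_ : NonZero d}} → (m + n % d) % d ≡ (m + n) % d
[m+n%d]%d≡[m+n]%d m n d = begin
  (m + n % d) % d ≡⟨ cong (_% d) (+-comm m (n % d)) ⟩
  (n % d + m) % d ≡⟨ [m%d+n]%d≡[m+n]%d n m d ⟩
  (n + m) % d     ≡⟨ cong (_% d) (+-comm n m) ⟩
  (m + n) % d     ∎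
  where open ≡-Reasoning

toℕ-⊕ : ∀ a b → toℕ (a ⊕ b) ≡ (toℕ a + toℕ b) % 5
toℕ-⊕ a b = toℕ-fromℕ< (m%n<n (toℕ a + toℕ b) 5)

⊕-assoc : ∀ a b c → (a ⊕ b) ⊕ c ≡ a ⊕ (b ⊕ c)
⊕-assoc a b c = toℕ-injective (begin
  toℕ ((a ⊕ b) ⊕ c)           ≡⟨ toℕ-⊕ (a ⊕ b) c ⟩
  (toℕ (a ⊕ b) + z) % 5       ≡⟨ cong (λ t → (t + z) % 5) (toℕ-⊕ a b) ⟩
  ((x + y) % 5 + z) % 5       ≡⟨ [m%d+n]%d≡[m+n]%d (x + y) z 5 ⟩
  (x + y + z) % 5             ≡⟨ cong (_% 5) (+-assoc x y z) ⟩
  (x + (y + z)) % 5           ≡⟨ [m+n%d]%d≡[m+n]%d x (y + z) 5 ⟨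
  (x + (y + z) % 5) % 5       ≡⟨ cong (λ t → (x + t) % 5) (toℕ-⊕ b c) ⟨
  (x + toℕ (b ⊕ c)) % 5       ≡⟨ toℕ-⊕ a (b ⊕ c) ⟨
  toℕ (a ⊕ (b ⊕ c))           ∎)
  where
  open ≡-Reasoning
  x y z : ℕ
  x = toℕ a
  y = toℕ b
  z = toℕ c

⊕-comm : ∀ a b → a ⊕ b ≡ b ⊕ a
⊕-comm a b = toℕ-injective (begin
  toℕ (a ⊕ b)          ≡⟨ toℕ-⊕ a b ⟩
  (toℕ a + toℕ b) % 5  ≡⟨ cong (_% 5) (+-comm (toℕ a) (toℕ b)) ⟩
  (toℕ b + toℕ a) % 5  ≡⟨ toℕ-⊕ b a ⟨
  toℕ (b ⊕ a)          ∎)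
  where open ≡-Reasoning

⊕-identityˡ : ∀ a → 0F ⊕ a ≡ a
⊕-identityˡ a = toℕ-injective (trans (toℕ-⊕ 0F a) (m<n⇒m%n≡m (toℕ<n a)))

⊕-identityʳ : ∀ a → a ⊕ 0F ≡ a
⊕-identityʳ a = trans (⊕-comm a 0F) (⊕-identityˡ a)

⊕-0-isCommutativeMonoid : IsCommutativeMonoid _≡_ _⊕_ 0F
⊕-0-isCommutativeMonoid = record
  { isMonoid = record
    { isSemigroup = record
      { isMagma = record { isEquivalence = isEquivalence ; ∙-cong = cong₂ _⊕_ }
      ; assoc = ⊕-assoc
      }
    ; identity = ⊕-identityˡ , ⊕-identityʳ
    }
  ; comm = ⊕-comm
  }

⊕-0-commutativeMonoid : CommutativeMonoid 0ℓ 0ℓ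
⊕-0-commutativeMonoid = record { isCommutativeMonoid = ⊕-0-isCommutativeMonoid }

open CommutativeMonoidSum ⊕-0-commutativeMonoid using (sum; sum-cong-≗; sum-permute; ∑-distrib-+)

diagSum≡sum : ∀ R σ → diagSum R σ ≡ sum (λ r → R r (σ r))
diagSum≡sum R σ = refl

sum-Q5≡0 : sum (λ (x : Q5) → x) ≡ 0F
sum-Q5≡0 = refl

sum-permutation≡0 : (P : Permutation′ 5) → sum (P ⟨$⟩ʳ_) ≡ 0F
sum-permutation≡0 P = trans (sym (sum-permute (λ x → x) P)) sum-Q5≡0

sum-injective≡0 : {f : Q5 → Q5} → Injective _≡_ _≡_ f → sum f ≡ 0F
sum-injective≡0 {f} f-inj = sum-permutation≡0 (injective⇒permutation f f-inj)

hasTransversal⇒hasZeroSumDiagonal : (π : Q5 → Permutation′ 5) →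
                                    HasTransversal (cubeOf π) → HasZeroSumDiagonal (rowSquareOf π)
hasTransversal⇒hasZeroSumDiagonal π (T , a-inj , b-inj , c-inj , s-inj) =
  σ ⟨$⟩ʳ_ , ⟨$⟩ʳ-injective σ , diagonal-sum≡0
  where
  a b c : Fin 5 → Q5
  a = c₀ ∘ T
  b = c₁ ∘ T
  c = c₂ ∘ T
  A B : Permutation′ 5
  A = injective⇒permutation a a-inj
  B = injective⇒permutation b b-inj
  σ : Permutation′ 5
  σ = flip A ∘ₚ B
  R : Square
  R = rowSquareOf π
  p : Fin 5 → Q5
  p k = π (a k) ⟨$⟩ʳ b k
  σ∘a≡b : ∀ k → σ ⟨$⟩ʳ a k ≡ b k
  σ∘a≡b k = cong b (inverseˡ A)
  sum-p≡0 : sum p ≡ 0F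
  sum-p≡0 = begin
    sum p                        ≡⟨ ⊕-identityʳ (sum p) ⟨
    sum p ⊕ 0F                   ≡⟨ cong (sum p ⊕_) (sum-injective≡0 c-inj) ⟨
    sum p ⊕ sum c                ≡⟨ ∑-distrib-+ p c ⟨
    sum (symbol (cubeOf π) ∘ T)  ≡⟨ sum-injective≡0 s-inj ⟩
    0F                           ∎
    where open ≡-Reasoning
  diagonal-sum≡0 : diagSum R (σ ⟨$⟩ʳ_) ≡ 0F
  diagonal-sum≡0 = begin
    diagSum R (σ ⟨$⟩ʳ_)                ≡⟨ diagSum≡sum R (σ ⟨$⟩ʳ_) ⟩
    sum (λ r → R r (σ ⟨$⟩ʳ r))         ≡⟨ sum-permute (λ r → R r (σ ⟨$⟩ʳ r)) A ⟩
    sum (λ k → R (a k) (σ ⟨$⟩ʳ a k))   ≡⟨ sum-cong-≗ (λ k → cong (π (a k) ⟨$⟩ʳ_) (σ∘a≡b k)) ⟩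
    sum p                              ≡⟨ sum-p≡0 ⟩
    0F                                 ∎
    where open ≡-Reasoning

corollary3 : (π : Q5 → Permutation′ 5) →
             ¬ HasZeroSumDiagonal (rowSquareOf π) →
             ¬ HasTransversal (cubeOf π)
corollary3 π noZeroSumDiagonal = noZeroSumDiagonal ∘ hasTransversal⇒hasZeroSumDiagonal π
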